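{- Let $\varphi(\bm x,\bm y,\bm z)$ be the Presburger formula \[ \bigwedge_{i=1}^n \bm{r}_i^\top \bm{x} < \bm{s}_i^\top\bm{y} + \bm{t}_i^\top\bm{z}+h_i ~~\wedge~~ \bigwedge_{j=1}^m \bm{u}_j^\top \bm{x}\approx_{e_j}^j \bm{v}_j^\top\bm{y}+\bm{w}_j^\top\bm{z}+d_j, \] let $\bm c$ be an integer vector and $\bm p\in\mathbb{Z}_\omega^{2n}$ a profile. There exists a sequence compatible with $\bm{p}$ for $\bm{c}$ if and only if there are integer vectors $\bm{a}_0,\bm{a}$ with $\bm{a} \ne \bm{0}$ such that $\bm{A}_{\bm{p},\bm{c}}\bm{a}_0\ge\bm{b}_{\bm{p},\bm{c}}$, $\bm{A}_{\bm{p},\bm{c}}\bm{a}\ge \bm{0}$, $\bm{B}_{\bm{p}}\bm{a}\gg\bm{0}$, and for all $j \in [1,m]$: $\bm{u}_j^\top\bm{a}_0\approx_{e_j}^j\bm{v}_j^\top(\bm{a}_0+\bm{a})+\bm{w}_j^\top\bm{c}+d_j$ and $\bm{u}_j^\top\bm{a}\equiv_{e_j} \bm{v}_j^\top\bm{a}\equiv_{e_j} 0$.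
   Context: Here $\bm r_i,\bm s_i,\bm t_i,\bm u_j,\bm v_j,\bm w_j$ are integer vectors, $h_i,d_j\in\mathbb{Z}$, $e_j>0$, and each $\approx_{e_j}^j$ is $\equiv_{e_j}$ or $\not\equiv_{e_j}$, where $s\equiv_e t$ means $e\mid s-t$. $\mathbb{Z}_\omega=\mathbb{Z}\cup\{\omega\}$ with $\omega$ greater than every integer (acting as $+\infty$); a profile is $\bm p=(p_1,\ldots,p_{2n})\in\mathbb{Z}_\omega^{2n}$. A sequence $\bm a_1,\bm a_2,\ldots$ of pairwise distinct integer vectors is compatible with $\bm p$ for $\bm c$ if for all $k<\ell$ and $j\in[1,m]$, $\bm{u}_j^\top\bm{a}_k\approx_{e_j}^j \bm{v}_j^\top\bm{a}_\ell+\bm{w}_j^\top\bm{c}+d_j$, and for every $i\in[1,n]$, $\sup_k \bm{r}_i^\top\bm{a}_k\le p_{2i-1}$ and $p_{2i}\le\liminf_k (\bm{s}_i^\top\bm{a}_k+\bm{t}_i^\top\bm{c}+h_i)$ (with $\omega$ identified with $+\infty$). The system $\bm{A}_{\bm{p},\bm{c}}\bm{x}\ge\bm{b}_{\bm{p},\bm{c}}$ consists of the inequality $\bm{r}_i^\top\bm{x}\le p_{2i-1}$ (i.e. row $-\bm r_i^\top$ with right-hand side $-p_{2i-1}$) for each $i$ with $p_{2i-1}\in\mathbb{Z}$, and the inequality $p_{2i}\le \bm{s}_i^\top\bm{x}+\bm{t}_i^\top\bm{c}+h_i$ (row $\bm s_i^\top$ with right-hand side $p_{2i}-\bm t_i^\top\bm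 c-h_i$) for each $i$ with $p_{2i}\in\mathbb{Z}$. The matrix $\bm B_{\bm p}$ has a row $\bm s_i^\top$ for each $i$ with $p_{2i}=\omega$. For vectors, $\bm x\ge\bm y$ is componentwise, and $\bm x\gg\bm y$ means $x_i>y_i$ for every component $i$. -}

module Defs where

open import Data.Nat as ℕ using (ℕ)
open import Data.Integer using (ℤ; +_; 0ℤ; _+_; _-_; _*_; -_; _≤_; _<_)
open import Data.Integer.Divisibility using (_∣_)
open import Data.Fin using (Fin)
open import Data.Vec as Vec using (Vec; replicate; zipWith; foldr′)
open import Data.List as List using (List; []; _∷_; _++_; concatMap; allFin)
open import Data.List.Relation.Unary.All using (All)
open import Data.Product using (_×_; _,_; proj₁; proj₂; ∃-syntax)
open import Data.Unit using (⊤)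
open import Relation.Nullary using (¬_)
open import Relation.Binary.PropositionalEquality using (_≡_; _≢_)

-- ℤ_ω = ℤ ∪ {ω}, with ω greater than every integer (acting as +∞)

data ℤω : Set where
  fin : ℤ → ℤω
  ω   : ℤω

_≤ω_ : ℤ → ℤω → Set
x ≤ω fin p = x ≤ p
x ≤ω ω     = ⊤

_<ω_ : ℤ → ℤω → Set
x <ω fin p = x < p
x <ω ω     = ⊤

_·_ : ∀ {d} → Vec ℤ d → Vec ℤ d → ℤ
u · x = foldr′ _+_ 0ℤ (zipWith _*_ u x)

infix 7 _·_

0ᵥ : ∀ {d} → Vec ℤ d
0ᵥ {d} = replicate d 0ℤ

_≡[_]_ : ℤ → ℕ → ℤ → Set
s ≡[ e ] t = (+ e) ∣ (s - t)

data RelKind : Set where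
  cong ncong : RelKind

⟦_⟧[_] : RelKind → ℕ → ℤ → ℤ → Set
⟦ cong  ⟧[ e ] s t = s ≡[ e ] t
⟦ ncong ⟧[ e ] s t = ¬ (s ≡[ e ] t)

-- The data of the Presburger formula
--   φ(x,y,z) = ⋀ᵢ rᵢᵀx < sᵢᵀy + tᵢᵀz + hᵢ  ∧  ⋀ⱼ uⱼᵀx ≈ʲ_{eⱼ} vⱼᵀy + wⱼᵀz + dⱼ
-- with x, y ∈ ℤ^d, z ∈ ℤ^q, i ∈ [1,n], j ∈ [1,m].

record Formula (d q n m : ℕ) : Set where
  field
    r s : Fin n → Vec ℤ d
    t   : Fin n → Vec ℤ q
    h   : Fin n → ℤ
    u v : Fin m → Vec ℤ d
    w   : Fin m → Vec ℤ q
    dd  : Fin m → ℤ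
    e   : Fin m → ℕ
    e>0 : (j : Fin m) → 0 ℕ.< e j
    rel : Fin m → RelKind

  _≈[_]_ : ℤ → Fin m → ℤ → Set
  a ≈[ j ] b = ⟦ rel j ⟧[ e j ] a b

-- A profile p = (p₁,…,p₂ₙ) ∈ ℤ_ω^{2n}, stored as the pairs (p_{2i-1}, p_{2i}).
Profile : ℕ → Set
Profile n = Fin n → ℤω × ℤω

SupLe : (ℕ → ℤ) → ℤω → Set
SupLe f p = ∀ k → f k ≤ω p

LeLiminf : ℤω → (ℕ → ℤ) → Set
LeLiminf p f = ∀ (M : ℤ) → M <ω p → ∃[ K ] (∀ k → K ℕ.≤ k → M < f k)

module _ {d q n m : ℕ} (φ : Formula d q n m) where
  open Formula φ

  -- a₁,a₂,… (indexed from 0 here) compatible with p for c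
  Compatible : Profile n → Vec ℤ q → (ℕ → Vec ℤ d) → Set
  Compatible p c a =
      (∀ k ℓ → k ≢ ℓ → a k ≢ a ℓ)
    × (∀ k ℓ → k ℕ.< ℓ → (j : Fin m) →
         (u j · a k) ≈[ j ] (v j · a ℓ + w j · c + dd j))
    × (∀ (i : Fin n) →
         SupLe (λ k → r i · a k) (proj₁ (p i))
       × LeLiminf (proj₂ (p i)) (λ k → s i · a k + t i · c + h i))

  -- rows (row , right-hand side) of the system A_{p,c} x ≥ b_{p,c}
  upperRows : Fin n → ℤω → List (Vec ℤ d × ℤ)
  upperRows i (fin P) = (Vec.map -_ (r i) , - P) ∷ []
  upperRows i ω       = []

  lowerRows : Vec ℤ q → Fin n → ℤω → List (Vec ℤ d × ℤ)
  lowerRows c i (fin P) = (s i , P - t i · c - h i) ∷ []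
  lowerRows c i ω       = []

  A-b : Profile n → Vec ℤ q → List (Vec ℤ d × ℤ)
  A-b p c = concatMap (λ i → upperRows i (proj₁ (p i)) ++ lowerRows c i (proj₂ (p i)))
                      (allFin n)

  bRows : Fin n → ℤω → List (Vec ℤ d)
  bRows i (fin _) = []
  bRows i ω       = s i ∷ []

  B : Profile n → List (Vec ℤ d)
  B p = concatMap (λ i → bRows i (proj₂ (p i))) (allFin n)

  A≥b : Profile n → Vec ℤ q → Vec ℤ d → Set
  A≥b p c x = All (λ rb → proj₂ rb ≤ proj₁ rb · x) (A-b p c)

  A≥0 : Profile n → Vec ℤ q → Vec ℤ d → Set
  A≥0 p c x = All (λ rb → 0ℤ ≤ proj₁ rb · x) (A-b p c)

  B≫0 : Profile n → Vec ℤ d → Set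
  B≫0 p x = All (λ row → 0ℤ < row · x) (B p)

-- If (a₀, a) is a certificate, the arithmetic progression a₀ + k·a is compatible:
-- the rows of A_{p,c} keep the bounds of the profile along it, each row of B_p
-- grows linearly, and since eⱼ divides uⱼᵀa and vⱼᵀa, adding multiples of a
-- changes none of the congruences.  Conversely, a compatible sequence eventually
-- satisfies A_{p,c} x ≥ b_{p,c}, and has a subsequence along which every row of
-- B_p strictly increases.  Dickson's lemma, in the constructive form of
-- almost-full relations, applied to the slacks of the rows of A_{p,c} and to the
-- residues of uⱼᵀx and vⱼᵀx modulo eⱼ, yields two terms a_k, a_ℓ (k < ℓ) of that
-- subsequence at which all these quantities are comparable, and then a₀ = a_k,
-- a = a_ℓ − a_k is a certificate.
module Submission where

open import Defs
open import Data.Nat using (ℕ)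
open import Data.Integer using (ℤ; _+_; 0ℤ)
open import Data.Fin using (Fin)
open import Data.Vec using (Vec; zipWith)
open import Data.Product using (_×_; ∃-syntax)
open import Function.Bundles using (_⇔_)
open import Relation.Binary.PropositionalEquality using (_≢_)

open import Data.Nat as ℕ using (zero; suc; z≤n; z<s; s<s; NonZero)
import Data.Nat.Properties as ℕP
open import Data.Integer as ℤ using (+_; -[1+_]; +[1+_]; _-_; _*_; -_; _≤_; _<_; +≤+; pred)
import Data.Integer.Properties as ℤP
open import Data.Integer.Tactic.RingSolver using (solve-∀)
open import Data.Integer.DivMod using (_%ℕ_; _/ℕ_; a≡a%ℕn+[a/ℕn]*n; n%ℕd<d)
import Data.Integer.Divisibility.Signed as Signed
open import Data.Vec using ([]; _∷_; map)
import Data.Vec.Properties as VecP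
open import Data.List using (List; []; _∷_; _++_; concatMap; allFin)
open import Data.List.Relation.Unary.All as All using (All; []; _∷_)
import Data.List.Relation.Unary.All.Properties as AllP
open import Data.Product as Product using (_,_; proj₁; proj₂)
open import Data.Sum using (_⊎_; inj₁; inj₂; [_,_]′; map₁; map₂)
import Data.Sum as Sum
open import Data.Unit using (tt)
open import Function using (_∘_; mk⇔)
open import Function.Bundles using (Equivalence)
open import Algebra.Properties.AbelianGroup ℤP.+-0-abelianGroup using (∙-cancelˡ)
open import Level using (0ℓ)
open import Relation.Binary.Core using (Rel)
open import Relation.Binary.Definitions using (Transitive)
open import Relation.Binary.Construct.Intersection using (_∩_)
open import Relation.Binary.PropositionalEquality
  using (_≡_; refl; sym; trans; subst; subst₂; _≗_; module ≡-Reasoning)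
import Relation.Binary.PropositionalEquality as ≡
open import Relation.Nullary using (contradiction)

private
  variable
    X Y : Set

-- Almost-full relations

_↑_ : Rel X 0ℓ → X → Rel X 0ℓ
(R ↑ x) y z = R y z ⊎ R x y

-- R is almost full when every sequence f has i < j with R (f i) (f j);
-- this is the inductive formulation of Vytiniotis, Coquand and Wahlstedt.
data AF {X : Set} (R : Rel X 0ℓ) : Set where
  full  : (∀ x y → R x y) → AF R
  later : (∀ x → AF (R ↑ x)) → AF R

AF-mono : {R S : Rel X 0ℓ} → (∀ x y → R x y → S x y) → AF R → AF S
AF-mono R⇒S (full r)  = full λ x y → R⇒S x y (r x y)
AF-mono R⇒S (later r) = later λ x → AF-mono (λ y z → Sum.map (R⇒S y z) (R⇒S x y)) (r x)

AF-comap : {R : Rel X 0ℓ} (g : Y → X) → AF R → AF (λ y y′ → R (g y) (g y′))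
AF-comap g (full r)  = full λ _ _ → r _ _
AF-comap g (later r) = later λ y → AF-comap g (r (g y))

AF-good : {R : Rel X 0ℓ} → AF R → (f : ℕ → X) → ∃[ i ] ∃[ j ] i ℕ.< j × R (f i) (f j)
AF-good (full r) f = 0 , 1 , z<s , r _ _
AF-good (later r) f with AF-good (r (f 0)) (f ∘ suc)
... | i , j , i<j , inj₁ Rij = suc i , suc j , s<s i<j , Rij
... | i , _ , _   , inj₂ R0i = 0 , suc i , z<s , R0i

AF-≤-or-≥ : ∀ b → AF (λ y z → y ℕ.≤ z ⊎ b ℕ.≤ y)
AF-≤-or-≥ zero    = full λ _ _ → inj₂ z≤n
AF-≤-or-≥ (suc b) = later λ x → step x (ℕP.≤-<-connex x b)
  where
  step : ∀ x → x ℕ.≤ b ⊎ b ℕ.< x →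
         AF (λ y z → (y ℕ.≤ z ⊎ suc b ℕ.≤ y) ⊎ (x ℕ.≤ y ⊎ suc b ℕ.≤ x))
  step x (inj₁ x≤b) = AF-mono (λ _ _ → Sum.map inj₁ (inj₁ ∘ ℕP.≤-trans x≤b)) (AF-≤-or-≥ b)
  step x (inj₂ b<x) = full λ _ _ → inj₂ (inj₂ b<x)

AF-≤ : AF ℕ._≤_
AF-≤ = later AF-≤-or-≥

-- The nullary and unary "stop" lemmas of Vytiniotis–Coquand–Wahlstedt, from
-- which closure of AF under intersection follows.
AF-∪-nullary : {P Q R : Rel X 0ℓ} {A B : Set} →
  AF P → (∀ x y → P x y → R x y ⊎ A) →
  AF Q → (∀ x y → Q x y → R x y ⊎ B) →
  AF (λ x y → R x y ⊎ A × B)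
AF-∪-nullary (full p) hP q hQ =
  AF-mono (λ x y → [ inj₁ , (λ b → map₂ (_, b) (hP x y (p x y))) ]′ ∘ hQ x y) q
AF-∪-nullary {R = R} (later p) hP q hQ = later λ x →
  AF-mono (λ _ _ → [ Sum.map inj₁ inj₁ , inj₁ ∘ inj₂ ]′)
    (AF-∪-nullary {R = R ↑ x} (p x)
      (λ y z → [ map₁ inj₁ ∘ hP y z , map₁ inj₂ ∘ hP x y ]′) q
      (λ y z → map₁ inj₁ ∘ hQ y z))

AF-∪-unary : {P Q R : Rel X 0ℓ} {U V : X → Set} →
  AF P → (∀ x y → P x y → R x y ⊎ U x) →
  AF Q → (∀ x y → Q x y → R x y ⊎ V x) →
  AF (λ x y → R x y ⊎ U x × V x)
AF-∪-unary (full p) hP q hQ =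
  AF-mono (λ x y → [ inj₁ , (λ v → map₂ (_, v) (hP x y (p x y))) ]′ ∘ hQ x y) q
AF-∪-unary (later p) hP (full q) hQ =
  AF-mono (λ x y → [ inj₁ , (λ u → map₂ (u ,_) (hQ x y (q x y))) ]′ ∘ hP x y) (later p)
AF-∪-unary {R = R} {U = U} {V = V} (later p) hP (later q) hQ = later λ x →
  AF-mono (λ _ _ → [ [ Sum.map inj₁ inj₁ , inj₁ ∘ inj₂ ]′ , inj₂ ∘ inj₂ ]′)
    (AF-∪-nullary
      (AF-∪-unary {R = λ y z → (R ↑ x) y z ⊎ U x} (p x)
        (λ y z → [ map₁ (inj₁ ∘ inj₁) ∘ hP y z , inj₁ ∘ map₁ inj₂ ∘ hP x y ]′)
        (later q) (λ y z → map₁ (inj₁ ∘ inj₁) ∘ hQ y z))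
      (λ _ _ → [ map₁ inj₁ , inj₁ ∘ inj₂ ]′)
      (AF-∪-unary {R = λ y z → (R ↑ x) y z ⊎ V x} (later p)
        (λ y z → map₁ (inj₁ ∘ inj₁) ∘ hP y z)
        (q x) (λ y z → [ map₁ (inj₁ ∘ inj₁) ∘ hQ y z , inj₁ ∘ map₁ inj₂ ∘ hQ x y ]′))
      (λ _ _ → [ map₁ inj₁ , inj₁ ∘ inj₂ ]′))

AF-∩ : {R S : Rel X 0ℓ} → AF R → AF S → AF (R ∩ S)
AF-∩ (full r) s = AF-mono (λ x y → r x y ,_) s
AF-∩ (later r) (full s) = AF-mono (λ x y → _, s x y) (later r)
AF-∩ {R = R} {S} (later r) (later s) = later λ x →
  AF-∪-unary {R = R ∩ S}
    (AF-∩ (r x) (later s)) (λ _ _ → λ { (inj₁ r , s) → inj₁ (r , s) ; (inj₂ r , _) → inj₂ r })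
    (AF-∩ (later r) (s x)) (λ _ _ → λ { (r , inj₁ s) → inj₁ (r , s) ; (_ , inj₂ s) → inj₂ s })

AF-All : {A : Set} (F : A → Rel X 0ℓ) (as : List A) → (∀ a → AF (F a)) →
         AF (λ x y → All (λ a → F a x y) as)
AF-All F []       _  = full λ _ _ → []
AF-All F (a ∷ as) af = AF-mono (λ _ _ (f , fs) → f ∷ fs) (AF-∩ (af a) (AF-All F as af))

AF-∀ : ∀ n (F : Fin n → Rel X 0ℓ) → (∀ j → AF (F j)) → AF (λ x y → ∀ j → F j x y)
AF-∀ zero    F _  = full λ _ _ ()
AF-∀ (suc n) F af = AF-mono (λ _ _ (f , fs) → λ { Fin.zero → f ; (Fin.suc j) → fs j })
                            (AF-∩ (af Fin.zero) (AF-∀ n (F ∘ Fin.suc) (af ∘ Fin.suc)))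

-- Comparing both f and b ∸ f forces equality.
AF-≡-bounded : (f : X → ℕ) (b : ℕ) → (∀ x → f x ℕ.≤ b) → AF (λ x y → f x ≡ f y)
AF-≡-bounded f b f≤b =
  AF-mono (λ x y (fx≤fy , b∸fx≤b∸fy) → ℕP.≤-antisym fx≤fy (ℕP.∸-cancelʳ-≤ (f≤b y) b∸fx≤b∸fy))
          (AF-∩ (AF-comap f AF-≤) (AF-comap (λ x → b ℕ.∸ f x) AF-≤))

Eventually : (ℕ → Set) → Set
Eventually P = ∃[ K ] (∀ k → K ℕ.≤ k → P k)

Eventually-All : {A : Set} {Q : A → ℕ → Set} (as : List A) →
  All (λ a → Eventually (Q a)) as → Eventually (λ k → All (λ a → Q a k) as)
Eventually-All []       []                = 0 , λ _ _ → []
Eventually-All (a ∷ as) ((K , hK) ∷ evs) with Eventually-All as evs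
... | K′ , hK′ = K ℕ.⊔ K′ , λ k K⊔K′≤k →
  hK k (ℕP.m⊔n≤o⇒m≤o K K′ K⊔K′≤k) ∷ hK′ k (ℕP.m⊔n≤o⇒n≤o K K′ K⊔K′≤k)

chain : {R : Rel X 0ℓ} (f : ℕ → X) → Transitive R →
  (∀ t → R (f t) (f (suc t))) → ∀ {i j} → i ℕ.< j → R (f i) (f j)
chain {R = R} f R-trans step {i} {suc j} i<1+j with ℕP.m<1+n⇒m<n∨m≡n i<1+j
... | inj₁ i<j  = R-trans (chain {R = R} f R-trans step i<j) (step j)
... | inj₂ refl = step i

subsequence : {R : Rel ℕ 0ℓ} → Transitive R → (∀ i → Eventually (R i)) → (K : ℕ) →
  ∃[ σ ] (∀ t → K ℕ.≤ σ t) × (∀ {i j} → i ℕ.< j → σ i ℕ.< σ j × R (σ i) (σ j))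
subsequence {R} R-trans ev K =
  σ , K≤σ , chain {R = λ s t → s ℕ.< t × R s t} σ
                  (λ (i<j , Rij) (j<k , Rjk) → ℕP.<-trans i<j j<k , R-trans Rij Rjk) step
  where
  σ : ℕ → ℕ
  σ zero    = K
  σ (suc t) = suc (σ t) ℕ.⊔ proj₁ (ev (σ t))
  step : ∀ t → σ t ℕ.< σ (suc t) × R (σ t) (σ (suc t))
  step t = ℕP.m≤m⊔n (suc (σ t)) Kₜ , proj₂ (ev (σ t)) _ (ℕP.m≤n⊔m (suc (σ t)) Kₜ)
    where Kₜ = proj₁ (ev (σ t))
  K≤σ : ∀ t → K ℕ.≤ σ t
  K≤σ zero    = ℕP.≤-refl
  K≤σ (suc t) = ℕP.≤-trans (K≤σ t) (ℕP.<⇒≤ (proj₁ (step t)))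

≤-by-difference : ∀ {i j i′ j′} → j - i ≡ j′ - i′ → i ≤ j → i′ ≤ j′
≤-by-difference eq i≤j = ℤP.0≤i-j⇒j≤i (subst (0ℤ ≤_) eq (ℤP.i≤j⇒0≤j-i i≤j))

i<j⇒0<j-i : ∀ {i j} → i < j → 0ℤ < j - i
i<j⇒0<j-i {i} {j} i<j = subst (_< j - i) (ℤP.+-inverseʳ i) (ℤP.+-monoˡ-< (- i) i<j)

<-by-difference : ∀ {i j i′ j′} → j - i ≡ j′ - i′ → i < j → i′ < j′
<-by-difference {i′ = i′} {j′} eq i<j =
  subst₂ _<_ (ℤP.+-identityˡ i′) (j-i+i≡j j′ i′) (ℤP.+-monoˡ-< i′ (subst (0ℤ <_) eq (i<j⇒0<j-i i<j)))
  where
  j-i+i≡j : ∀ j i → j - i + i ≡ j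
  j-i+i≡j = solve-∀

i-k-l≤j⇔i≤j+k+l : ∀ i j k l → (i - k - l ≤ j) ⇔ (i ≤ j + k + l)
i-k-l≤j⇔i≤j+k+l i j k l = mk⇔ (≤-by-difference (sym (lemma i j k l))) (≤-by-difference (lemma i j k l))
  where
  lemma : ∀ i j k l → j + k + l - i ≡ j - (i - k - l)
  lemma = solve-∀

below-ℕ : ∀ z → ∃[ K ] z < + K
below-ℕ (+ n)    = suc n , ℤ.+<+ ℕP.≤-refl
below-ℕ -[1+ n ] = 0 , ℤ.-<+

progression : ℤ → ℤ → ℕ → ℤ
progression x y k = x + + k * y

progression-≤ : ∀ {x y P} → y ≤ 0ℤ → x ≤ P → ∀ k → progression x y k ≤ P
progression-≤ {x} {y} {P} y≤0 x≤P k =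
  subst (progression x y k ≤_) (ℤP.+-identityʳ P) (ℤP.+-mono-≤ x≤P ky≤0)
  where
  ky≤0 : + k * y ≤ 0ℤ
  ky≤0 = subst (+ k * y ≤_) (ℤP.*-zeroʳ (+ k)) (ℤP.*-monoˡ-≤-nonNeg (+ k) y≤0)

progression-≥ : ∀ {x y P} → 0ℤ ≤ y → P ≤ x → ∀ k → P ≤ progression x y k
progression-≥ {x} {y} {P} 0≤y P≤x k =
  subst (_≤ progression x y k) (ℤP.+-identityʳ P) (ℤP.+-mono-≤ P≤x 0≤ky)
  where
  0≤ky : 0ℤ ≤ + k * y
  0≤ky = subst (_≤ + k * y) (ℤP.*-zeroʳ (+ k)) (ℤP.*-monoˡ-≤-nonNeg (+ k) 0≤y)

progression-repeat⇒0 : ∀ x y {k ℓ} → k ≢ ℓ → progression x y k ≡ progression x y ℓ → y ≡ 0ℤ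
progression-repeat⇒0 x (+ zero)     _   _  = refl
progression-repeat⇒0 x y@(+[1+ _ ]) k≢ℓ eq =
  contradiction (ℤP.+-injective (ℤP.*-cancelʳ-≡ _ _ y (∙-cancelˡ x _ _ eq))) k≢ℓ
progression-repeat⇒0 x y@(-[1+ _ ]) k≢ℓ eq =
  contradiction (ℤP.+-injective (ℤP.*-cancelʳ-≡ _ _ y (∙-cancelˡ x _ _ eq))) k≢ℓ

LeLiminf-cong : ∀ {P f g} → f ≗ g → LeLiminf P f → LeLiminf P g
LeLiminf-cong f≗g lim M M<P = Product.map₂ (λ hK k K≤k → subst (M <_) (f≗g k) (hK k K≤k)) (lim M M<P)

≤-everywhere⇒LeLiminf : ∀ {P f} → (∀ k → P ≤ f k) → LeLiminf (fin P) f
≤-everywhere⇒LeLiminf P≤f M M<P = 0 , λ k _ → ℤP.<-≤-trans M<P (P≤f k)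

LeLiminf⇒eventually-≤ : ∀ {P f} → LeLiminf (fin P) f → Eventually (λ k → P ≤ f k)
LeLiminf⇒eventually-≤ {P} lim =
  Product.map₂ (λ hK k K≤k → subst (_≤ _) (ℤP.suc-pred P) (ℤP.i<j⇒suc[i]≤j (hK k K≤k)))
               (lim (pred P) (ℤP.i≤pred[j]⇒i<j ℤP.≤-refl))

LeLiminf-ω-+ʳ⁺ : ∀ {f} z → LeLiminf ω f → LeLiminf ω (λ k → f k + z)
LeLiminf-ω-+ʳ⁺ {f} z lim M _ =
  Product.map₂ (λ hK k K≤k → <-by-difference (lemma (f k) z M) (hK k K≤k)) (lim (M - z) tt)
  where
  lemma : ∀ a z M → a - (M - z) ≡ a + z - M
  lemma = solve-∀

LeLiminf-ω-+ʳ⁻ : ∀ {f} z → LeLiminf ω (λ k → f k + z) → LeLiminf ω f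
LeLiminf-ω-+ʳ⁻ {f} z lim M _ =
  Product.map₂ (λ hK k K≤k → <-by-difference (lemma (f k) z M) (hK k K≤k)) (lim (M + z) tt)
  where
  lemma : ∀ a z M → a + z - (M + z) ≡ a - M
  lemma = solve-∀

progression-diverges : ∀ {x y} → 0ℤ < y → LeLiminf ω (progression x y)
progression-diverges {x} {y} 0<y M _ = K , λ k K≤k →
  <-by-difference (lemma x (+ k * y) M)
    (ℤP.<-≤-trans M-x<K (ℤP.≤-trans (+≤+ K≤k) (k≤ky k)))
  where
  K = proj₁ (below-ℕ (M - x))
  M-x<K : M - x < + K
  M-x<K = proj₂ (below-ℕ (M - x))
  k≤ky : ∀ k → + k ≤ + k * y
  k≤ky k = subst (_≤ + k * y) (ℤP.*-identityʳ (+ k)) (ℤP.*-monoˡ-≤-nonNeg (+ k) (ℤP.i<j⇒suc[i]≤j 0<y))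
  lemma : ∀ x ky M → ky - (M - x) ≡ x + ky - M
  lemma = solve-∀

∣⇒≡[] : ∀ {e} x y → + e Signed.∣ x - y → x ≡[ e ] y
∣⇒≡[] x y = Signed.∣⇒∣ᵤ

≡[]⇒∣ : ∀ {e} x y → x ≡[ e ] y → + e Signed.∣ x - y
≡[]⇒∣ {e} x y = Signed.∣ᵤ⇒∣ {+ e} {x - y}

≡[]-by-difference : ∀ {e} x y {z} → z ≡ x - y → + e Signed.∣ z → x ≡[ e ] y
≡[]-by-difference x y z≡x-y e∣z = ∣⇒≡[] x y (subst (_ Signed.∣_) z≡x-y e∣z)

≡[]0⇒∣ : ∀ {e} x → x ≡[ e ] 0ℤ → + e Signed.∣ x
≡[]0⇒∣ x x≡0 = subst (_ Signed.∣_) (ℤP.+-identityʳ x) (≡[]⇒∣ x 0ℤ x≡0)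

≡[]-sym : ∀ {e} x y → x ≡[ e ] y → y ≡[ e ] x
≡[]-sym x y x≡y = ≡[]-by-difference y x (lemma x y) (Signed.∣m⇒∣-m (≡[]⇒∣ x y x≡y))
  where
  lemma : ∀ x y → - (x - y) ≡ y - x
  lemma = solve-∀

≡[]-trans : ∀ {e} x y z → x ≡[ e ] y → y ≡[ e ] z → x ≡[ e ] z
≡[]-trans x y z x≡y y≡z =
  ≡[]-by-difference x z (ℤP.+-minus-telescope x y z) (Signed.∣m∣n⇒∣m+n (≡[]⇒∣ x y x≡y) (≡[]⇒∣ y z y≡z))

⟦⟧-resp-≡[] : ∀ k {e} x x′ y y′ → x ≡[ e ] x′ → y ≡[ e ] y′ → ⟦ k ⟧[ e ] x y → ⟦ k ⟧[ e ] x′ y′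
⟦⟧-resp-≡[] cong  x x′ y y′ x≡x′ y≡y′ x≡y =
  ≡[]-trans x′ x y′ (≡[]-sym x x′ x≡x′) (≡[]-trans x y y′ x≡y y≡y′)
⟦⟧-resp-≡[] ncong x x′ y y′ x≡x′ y≡y′ x≢y x′≡y′ =
  x≢y (≡[]-trans x x′ y x≡x′ (≡[]-trans x′ y′ y x′≡y′ (≡[]-sym y y′ y≡y′)))

%ℕ-≡⇒≡[] : ∀ e .{{_ : NonZero e}} x y → x %ℕ e ≡ y %ℕ e → x ≡[ e ] y
%ℕ-≡⇒≡[] e x y x%e≡y%e = ∣⇒≡[] x y (Signed.divides (x /ℕ e - y /ℕ e) x-y≡q*e)
  where
  open ≡-Reasoning
  lemma : ∀ r a b e → r + a * e - (r + b * e) ≡ (a - b) * e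
  lemma = solve-∀
  x-y≡q*e : x - y ≡ (x /ℕ e - y /ℕ e) * + e
  x-y≡q*e = begin
    x - y
      ≡⟨ ≡.cong₂ _-_ (a≡a%ℕn+[a/ℕn]*n x e) (a≡a%ℕn+[a/ℕn]*n y e) ⟩
    + (x %ℕ e) + x /ℕ e * + e - (+ (y %ℕ e) + y /ℕ e * + e)
      ≡⟨ ≡.cong (λ r → + (x %ℕ e) + x /ℕ e * + e - (+ r + y /ℕ e * + e)) (sym x%e≡y%e) ⟩
    + (x %ℕ e) + x /ℕ e * + e - (+ (x %ℕ e) + y /ℕ e * + e)
      ≡⟨ lemma (+ (x %ℕ e)) (x /ℕ e) (y /ℕ e) (+ e) ⟩
    (x /ℕ e - y /ℕ e) * + e ∎

AF-≡[] : ∀ e .{{_ : NonZero e}} (g : X → ℤ) → AF (λ x y → g y ≡[ e ] g x)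
AF-≡[] e g = AF-mono (λ x y gx≡gy → %ℕ-≡⇒≡[] e (g y) (g x) (sym gx≡gy))
                     (AF-≡-bounded (λ x → g x %ℕ e) e (λ x → ℕP.<⇒≤ (n%ℕd<d (g x) e)))

AF-≤-above : (β : ℤ) (g : X → ℤ) → AF (λ x y → β ≤ g x → β ≤ g y → g x ≤ g y)
AF-≤-above β g = AF-mono slack-≤⇒≤ (AF-comap (λ x → ℤ.∣ g x - β ∣) AF-≤)
  where
  lemma : ∀ a b β → b - β - (a - β) ≡ b - a
  lemma = solve-∀
  slack-≤⇒≤ : ∀ x y → ℤ.∣ g x - β ∣ ℕ.≤ ℤ.∣ g y - β ∣ → β ≤ g x → β ≤ g y → g x ≤ g y
  slack-≤⇒≤ x y slack≤ β≤gx β≤gy = ≤-by-difference (lemma (g x) (g y) β)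
    (subst₂ _≤_ (ℤP.0≤i⇒+∣i∣≡i (ℤP.i≤j⇒0≤j-i β≤gx)) (ℤP.0≤i⇒+∣i∣≡i (ℤP.i≤j⇒0≤j-i β≤gy)) (+≤+ slack≤))

infixl 6 _+ᵥ_ _-ᵥ_

_+ᵥ_ _-ᵥ_ : ∀ {d} → Vec ℤ d → Vec ℤ d → Vec ℤ d
x +ᵥ y = zipWith _+_ x y
x -ᵥ y = zipWith _-_ x y

progressionᵥ : ∀ {d} → Vec ℤ d → Vec ℤ d → ℕ → Vec ℤ d
progressionᵥ a₀ a k = a₀ +ᵥ map (+ k *_) a

·-distribˡ-+ᵥ : ∀ {d} (w x y : Vec ℤ d) → w · (x +ᵥ y) ≡ w · x + w · y
·-distribˡ-+ᵥ []       []       []       = refl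
·-distribˡ-+ᵥ (w ∷ ws) (x ∷ xs) (y ∷ ys) rewrite ·-distribˡ-+ᵥ ws xs ys = lemma w x y (ws · xs) (ws · ys)
  where
  lemma : ∀ w x y a b → w * (x + y) + (a + b) ≡ w * x + a + (w * y + b)
  lemma = solve-∀

·-distribˡ--ᵥ : ∀ {d} (w x y : Vec ℤ d) → w · (x -ᵥ y) ≡ w · x - w · y
·-distribˡ--ᵥ []       []       []       = refl
·-distribˡ--ᵥ (w ∷ ws) (x ∷ xs) (y ∷ ys) rewrite ·-distribˡ--ᵥ ws xs ys = lemma w x y (ws · xs) (ws · ys)
  where
  lemma : ∀ w x y a b → w * (x - y) + (a - b) ≡ w * x + a - (w * y + b)
  lemma = solve-∀

·-progressionᵥ : ∀ {d} (w a₀ a : Vec ℤ d) k → w · progressionᵥ a₀ a k ≡ progression (w · a₀) (w · a) k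
·-progressionᵥ []       []       []       k = sym (trans (ℤP.+-identityˡ _) (ℤP.*-zeroʳ (+ k)))
·-progressionᵥ (w ∷ ws) (x ∷ xs) (y ∷ ys) k rewrite ·-progressionᵥ ws xs ys k =
  lemma w x y (+ k) (ws · xs) (ws · ys)
  where
  lemma : ∀ w x y k a b → w * (x + k * y) + (a + k * b) ≡ w * x + a + k * (w * y + b)
  lemma = solve-∀

neg-·-≤⇔ : ∀ {d} (ρ x : Vec ℤ d) P → (- P ≤ map -_ ρ · x) ⇔ (ρ · x ≤ P)
neg-·-≤⇔ ρ x P = mk⇔ (ℤP.neg-cancel-≤ ∘ subst (- P ≤_) (neg-· ρ x))
                     (subst (- P ≤_) (sym (neg-· ρ x)) ∘ ℤP.neg-mono-≤)
  where
  neg-· : ∀ {d} (ρ x : Vec ℤ d) → map -_ ρ · x ≡ - (ρ · x)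
  neg-· []       []       = refl
  neg-· (r ∷ ρ) (x ∷ xs) rewrite neg-· ρ xs = lemma r x (ρ · xs)
    where
    lemma : ∀ r x a → - r * x + - a ≡ - (r * x + a)
    lemma = solve-∀

+ᵥ-ᵥ-cancel : ∀ {d} (x y : Vec ℤ d) → x +ᵥ (y -ᵥ x) ≡ y
+ᵥ-ᵥ-cancel []       []       = refl
+ᵥ-ᵥ-cancel (x ∷ xs) (y ∷ ys) = ≡.cong₂ _∷_ (lemma x y) (+ᵥ-ᵥ-cancel xs ys)
  where
  lemma : ∀ x y → x + (y - x) ≡ y
  lemma = solve-∀

-ᵥ≡0ᵥ⇒≡ : ∀ {d} (x y : Vec ℤ d) → x -ᵥ y ≡ 0ᵥ → x ≡ y
-ᵥ≡0ᵥ⇒≡ []       []       _  = refl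
-ᵥ≡0ᵥ⇒≡ (x ∷ xs) (y ∷ ys) eq = ≡.cong₂ _∷_ (ℤP.i-j≡0⇒i≡j x y (VecP.∷-injectiveˡ eq))
                                          (-ᵥ≡0ᵥ⇒≡ xs ys (VecP.∷-injectiveʳ eq))

progressionᵥ-repeat⇒0 : ∀ {d} (a₀ a : Vec ℤ d) {k ℓ} → k ≢ ℓ →
  progressionᵥ a₀ a k ≡ progressionᵥ a₀ a ℓ → a ≡ 0ᵥ
progressionᵥ-repeat⇒0 []       []       _   _  = refl
progressionᵥ-repeat⇒0 (x ∷ xs) (y ∷ ys) k≢ℓ eq =
  ≡.cong₂ _∷_ (progression-repeat⇒0 x y k≢ℓ (VecP.∷-injectiveˡ eq))
            (progressionᵥ-repeat⇒0 xs ys k≢ℓ (VecP.∷-injectiveʳ eq))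

·-ᵥ-≡[]0 : ∀ {d e} (w x y : Vec ℤ d) → (w · y) ≡[ e ] (w · x) → (w · (y -ᵥ x)) ≡[ e ] 0ℤ
·-ᵥ-≡[]0 w x y wy≡wx = ≡[]-by-difference (w · (y -ᵥ x)) 0ℤ
  (trans (sym (·-distribˡ--ᵥ w y x)) (sym (ℤP.+-identityʳ _))) (≡[]⇒∣ (w · y) (w · x) wy≡wx)

All-concatMap-allFin⁺ : {A : Set} {Q : A → Set} {n : ℕ} (F : Fin n → List A) →
  (∀ i → All Q (F i)) → All Q (concatMap F (allFin n))
All-concatMap-allFin⁺ F = AllP.concat⁺ ∘ AllP.map⁺ ∘ AllP.tabulate⁺

All-concatMap-allFin⁻ : {A : Set} {Q : A → Set} {n : ℕ} (F : Fin n → List A) →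
  All Q (concatMap F (allFin n)) → ∀ i → All Q (F i)
All-concatMap-allFin⁻ F = AllP.tabulate⁻ ∘ AllP.map⁻ ∘ AllP.concat⁻

module _ {d q n m : ℕ} (φ : Formula d q n m) (c : Vec ℤ q) (p : Profile n) where
  open Formula φ
  open Equivalence using (to; from)

  Certificate : Vec ℤ d → Vec ℤ d → Set
  Certificate a₀ a =
      (a ≢ 0ᵥ) × A≥b φ p c a₀ × A≥0 φ p c a × B≫0 φ p a
    × (∀ j → (u j · a₀) ≈[ j ] (v j · (a₀ +ᵥ a) + w j · c + dd j)
           × (u j · a) ≡[ e j ] (v j · a)
           × (v j · a) ≡[ e j ] 0ℤ)

  rows : Fin n → List (Vec ℤ d × ℤ)
  rows i = upperRows φ i (proj₁ (p i)) ++ lowerRows φ c i (proj₂ (p i))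

  progression-SupLe : ∀ a₀ a i pv →
    All (λ rb → proj₂ rb ≤ proj₁ rb · a₀) (upperRows φ i pv) →
    All (λ rb → 0ℤ ≤ proj₁ rb · a) (upperRows φ i pv) →
    SupLe (λ k → r i · progressionᵥ a₀ a k) pv
  progression-SupLe a₀ a i ω       _            _           _ = tt
  progression-SupLe a₀ a i (fin P) (a₀-ok ∷ []) (a-ok ∷ []) k =
    subst (_≤ P) (sym (·-progressionᵥ (r i) a₀ a k))
      (progression-≤ (to (neg-·-≤⇔ (r i) a 0ℤ) a-ok) (to (neg-·-≤⇔ (r i) a₀ P) a₀-ok) k)

  progression-LeLiminf : ∀ a₀ a i pv →
    All (λ rb → proj₂ rb ≤ proj₁ rb · a₀) (lowerRows φ c i pv) →
    All (λ rb → 0ℤ ≤ proj₁ rb · a) (lowerRows φ c i pv) →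
    All (λ row → 0ℤ < row · a) (bRows φ i pv) →
    LeLiminf pv (λ k → s i · progressionᵥ a₀ a k + t i · c + h i)
  progression-LeLiminf a₀ a i (fin P) (a₀-ok ∷ []) (a-ok ∷ []) [] =
    ≤-everywhere⇒LeLiminf λ k → to (i-k-l≤j⇔i≤j+k+l P _ (t i · c) (h i))
      (subst (_ ≤_) (sym (·-progressionᵥ (s i) a₀ a k)) (progression-≥ a-ok a₀-ok k))
  progression-LeLiminf a₀ a i ω [] [] (0<sa ∷ []) =
    LeLiminf-ω-+ʳ⁺ (h i) (LeLiminf-ω-+ʳ⁺ (t i · c)
      (LeLiminf-cong (sym ∘ ·-progressionᵥ (s i) a₀ a) (progression-diverges {s i · a₀} 0<sa)))

  progression-related : ∀ a₀ a j →
    (u j · a₀) ≈[ j ] (v j · (a₀ +ᵥ a) + w j · c + dd j) →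
    (u j · a) ≡[ e j ] (v j · a) → (v j · a) ≡[ e j ] 0ℤ →
    ∀ k ℓ → (u j · progressionᵥ a₀ a k) ≈[ j ] (v j · progressionᵥ a₀ a ℓ + w j · c + dd j)
  progression-related a₀ a j related₀ ua≡va va≡0 k ℓ =
    ⟦⟧-resp-≡[] (rel j) _ uₖ _ vₗ u-side v-side related₀
    where
    e∣va : + e j Signed.∣ v j · a
    e∣va = ≡[]0⇒∣ _ va≡0
    e∣ua : + e j Signed.∣ u j · a
    e∣ua = ≡[]0⇒∣ _ (≡[]-trans (u j · a) (v j · a) 0ℤ ua≡va va≡0)
    u-lemma : ∀ x y → - y ≡ x - (x + y)
    u-lemma = solve-∀
    uₖ = u j · progressionᵥ a₀ a k
    vₗ = v j · progressionᵥ a₀ a ℓ + w j · c + dd j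
    u-side : (u j · a₀) ≡[ e j ] uₖ
    u-side = ≡[]-by-difference (u j · a₀) uₖ
      (trans (u-lemma (u j · a₀) (+ k * (u j · a)))
             (≡.cong (λ z → u j · a₀ - z) (sym (·-progressionᵥ (u j) a₀ a k))))
      (Signed.∣m⇒∣-m (Signed.∣n⇒∣m*n (+ k) e∣ua))
    v-lemma : ∀ x y ℓy z z′ → y - ℓy ≡ x + y + z + z′ - (x + ℓy + z + z′)
    v-lemma = solve-∀
    v-side : (v j · (a₀ +ᵥ a) + w j · c + dd j) ≡[ e j ] vₗ
    v-side = ≡[]-by-difference (v j · (a₀ +ᵥ a) + w j · c + dd j) vₗ
      (trans (v-lemma (v j · a₀) (v j · a) (+ ℓ * (v j · a)) (w j · c) (dd j))
             (≡.cong₂ (λ x y → x + w j · c + dd j - (y + w j · c + dd j))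
                      (sym (·-distribˡ-+ᵥ (v j) a₀ a)) (sym (·-progressionᵥ (v j) a₀ a ℓ))))
      (Signed.∣m∣n⇒∣m-n e∣va (Signed.∣n⇒∣m*n (+ ℓ) e∣va))

  certificate⇒compatible : ∀ {a₀ a} → Certificate a₀ a → Compatible φ p c (progressionᵥ a₀ a)
  certificate⇒compatible {a₀} {a} (a≢0 , a₀-ok , a-ok , a-B , related) =
      (λ k ℓ k≢ℓ eq → a≢0 (progressionᵥ-repeat⇒0 a₀ a k≢ℓ eq))
    , (λ k ℓ _ j → let related₀ , ua≡va , va≡0 = related j
                   in progression-related a₀ a j related₀ ua≡va va≡0 k ℓ)
    , λ i →
        let up₀ , low₀ = AllP.++⁻ _ (All-concatMap-allFin⁻ rows a₀-ok i)
            up  , low  = AllP.++⁻ _ (All-concatMap-allFin⁻ rows a-ok i)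
        in progression-SupLe a₀ a i (proj₁ (p i)) up₀ up
         , progression-LeLiminf a₀ a i (proj₂ (p i)) low₀ low (All-concatMap-allFin⁻ _ a-B i)

  upperRows-eventually : ∀ {a : ℕ → Vec ℤ d} i pv → SupLe (λ k → r i · a k) pv →
    All (λ rb → Eventually (λ k → proj₂ rb ≤ proj₁ rb · a k)) (upperRows φ i pv)
  upperRows-eventually         i ω       _   = []
  upperRows-eventually {a = a} i (fin P) sup = (0 , λ k _ → from (neg-·-≤⇔ (r i) (a k) P) (sup k)) ∷ []

  lowerRows-eventually : ∀ {a : ℕ → Vec ℤ d} i pv → LeLiminf pv (λ k → s i · a k + t i · c + h i) →
    All (λ rb → Eventually (λ k → proj₂ rb ≤ proj₁ rb · a k)) (lowerRows φ c i pv)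
  lowerRows-eventually         i ω       _   = []
  lowerRows-eventually {a = a} i (fin P) lim =
    Product.map₂ (λ hK k K≤k → from (i-k-l≤j⇔i≤j+k+l P (s i · a k) (t i · c) (h i)) (hK k K≤k))
                 (LeLiminf⇒eventually-≤ lim) ∷ []

  bRows-LeLiminf : ∀ {a : ℕ → Vec ℤ d} i pv → LeLiminf pv (λ k → s i · a k + t i · c + h i) →
    All (λ row → LeLiminf ω (λ k → row · a k)) (bRows φ i pv)
  bRows-LeLiminf i (fin _) _   = []
  bRows-LeLiminf i ω       lim = LeLiminf-ω-+ʳ⁻ (t i · c) (LeLiminf-ω-+ʳ⁻ (h i) lim) ∷ []

  Comparable : Rel (Vec ℤ d) 0ℓ
  Comparable x y =
      All (λ rb → proj₂ rb ≤ proj₁ rb · x → proj₂ rb ≤ proj₁ rb · y → proj₁ rb · x ≤ proj₁ rb · y)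
          (A-b φ p c)
    × (∀ j → (u j · y) ≡[ e j ] (u j · x) × (v j · y) ≡[ e j ] (v j · x))

  Comparable-AF : AF Comparable
  Comparable-AF = AF-∩
    (AF-All _ (A-b φ p c) λ rb → AF-≤-above (proj₂ rb) (proj₁ rb ·_))
    (AF-∀ m _ λ j → let instance _ = ℕ.>-nonZero (e>0 j)
                    in AF-∩ (AF-≡[] (e j) (u j ·_)) (AF-≡[] (e j) (v j ·_)))

  pair⇒certificate : ∀ {x y} → x ≢ y → A≥b φ p c x → A≥b φ p c y →
    All (λ row → row · x < row · y) (B φ p) → Comparable x y →
    (∀ j → (u j · x) ≈[ j ] (v j · y + w j · c + dd j)) →
    Certificate x (y -ᵥ x)
  pair⇒certificate {x} {y} x≢y x-ok y-ok B-increases (rows-comparable , residues) related =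
      (λ y-x≡0 → x≢y (sym (-ᵥ≡0ᵥ⇒≡ y x y-x≡0)))
    , x-ok
    , All.zipWith (λ {rb} (cmp , bx , by) → subst (0ℤ ≤_) (sym (·-distribˡ--ᵥ (proj₁ rb) y x))
                                                    (ℤP.i≤j⇒0≤j-i (cmp bx by)))
                  (rows-comparable , All.zip (x-ok , y-ok))
    , All.map (λ {row} x<y → subst (0ℤ <_) (sym (·-distribˡ--ᵥ row y x)) (i<j⇒0<j-i x<y)) B-increases
    , λ j → let u-res , v-res = residues j
                u≡0 = ·-ᵥ-≡[]0 (u j) x y u-res
                v≡0 = ·-ᵥ-≡[]0 (v j) x y v-res
            in subst (λ z → (u j · x) ≈[ j ] (v j · z + w j · c + dd j)) (sym (+ᵥ-ᵥ-cancel x y)) (related j)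
             , ≡[]-trans (u j · (y -ᵥ x)) 0ℤ (v j · (y -ᵥ x)) u≡0 (≡[]-sym (v j · (y -ᵥ x)) 0ℤ v≡0)
             , v≡0

  compatible⇒certificate : ∀ {a} → Compatible φ p c a → ∃[ a₀ ] ∃[ a′ ] Certificate a₀ a′
  compatible⇒certificate {a} (distinct , related , bounds) =
    let σ , K≤σ , σ-increasing = subsequence Increasing-trans Increasing-eventually (proj₁ eventually-ok)
        k , ℓ , k<ℓ , comparable = AF-good Comparable-AF (a ∘ σ)
        σk<σℓ , increases = σ-increasing k<ℓ
    in a (σ k) , a (σ ℓ) -ᵥ a (σ k) ,
       pair⇒certificate (distinct (σ k) (σ ℓ) (ℕP.<⇒≢ σk<σℓ))
         (proj₂ eventually-ok (σ k) (K≤σ k)) (proj₂ eventually-ok (σ ℓ) (K≤σ ℓ))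
         increases comparable (related (σ k) (σ ℓ) σk<σℓ)
    where
    eventually-ok : Eventually (λ k → A≥b φ p c (a k))
    eventually-ok = Eventually-All (A-b φ p c) (All-concatMap-allFin⁺ rows λ i →
      AllP.++⁺ (upperRows-eventually i (proj₁ (p i)) (proj₁ (bounds i)))
               (lowerRows-eventually i (proj₂ (p i)) (proj₂ (bounds i))))
    Increasing : Rel ℕ 0ℓ
    Increasing k ℓ = All (λ row → row · a k < row · a ℓ) (B φ p)
    Increasing-trans : Transitive Increasing
    Increasing-trans k<ℓ ℓ<m = All.zipWith (λ (x<y , y<z) → ℤP.<-trans x<y y<z) (k<ℓ , ℓ<m)
    Increasing-eventually : ∀ k → Eventually (Increasing k)
    Increasing-eventually k = Eventually-All (B φ p)
      (All.map (λ {row} lim → lim (row · a k) tt)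
               (All-concatMap-allFin⁺ _ λ i → bRows-LeLiminf i (proj₂ (p i)) (proj₂ (bounds i))))

lemma5p4 : ∀ {d q n m : ℕ} (φ : Formula d q n m) (c : Vec ℤ q) (p : Profile n) →
    (∃[ a ] Compatible φ p c a)
    ⇔
    (∃[ a₀ ] ∃[ a ]
        (a ≢ 0ᵥ)
      × A≥b φ p c a₀
      × A≥0 φ p c a
      × B≫0 φ p a
      × (∀ (j : Fin m) →
            Formula._≈[_]_ φ (Formula.u φ j · a₀) j
              (Formula.v φ j · zipWith _+_ a₀ a + Formula.w φ j · c + Formula.dd φ j)
          × (Formula.u φ j · a) ≡[ Formula.e φ j ] (Formula.v φ j · a)
          × (Formula.v φ j · a) ≡[ Formula.e φ j ] 0ℤ))
lemma5p4 φ c p = mk⇔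
  (λ (_ , compatible) → compatible⇒certificate φ c p compatible)
  (λ (a₀ , a , certificate) → progressionᵥ a₀ a , certificate⇒compatible φ c p certificate)
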